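{- The language $L_1=\{a\}^*\{b\}\{a,b\}^*$ belongs to $\mathrm{REG}_2^Z$ but not to $\mathrm{SLT}$.
   Context: $\mathrm{REG}_n^Z$ is the family of regular languages accepted by some deterministic finite automaton (with total transition function) with at most $n$ states. For $k\geq1$, a language $L$ over an alphabet $V$ is strictly locally $k$-testable (family $\mathrm{SLT}_k$) if there are sets $B,I,E\subseteq V^k$ and a finite set $F$ of words of length at most $k-1$ such that $L$ consists of the words of $F$ together with exactly those words $a_1a_2\cdots a_n$ ($n\geq k$, $a_i\in V$) for which $a_1\cdots a_k\in B$, $a_{j+1}\cdots a_{j+k}\in I$ for every $j$ with $1\leq j\leq n-k-1$, and $a_{n-k+1}\cdots a_n\in E$. $\mathrm{SLT}=\bigcup_{k\geq1}\mathrm{SLT}_k$. -}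

module Defs where

open import Level using (0ℓ)
open import Data.Nat using (ℕ; _≤_; _<_; _+_; suc)
open import Data.Fin using (Fin)
open import Data.Bool using (Bool; true)
open import Data.List using (List; []; _∷_; _++_; replicate; foldl; length; take; drop)
open import Data.Product using (Σ; Σ-syntax; ∃; _×_)
open import Data.Sum using (_⊎_)
open import Function.Bundles using (_⇔_)
open import Relation.Binary.PropositionalEquality using (_≡_)

Language : Set → Set₁
Language V = List V → Set

record DFA (V : Set) (m : ℕ) : Set where
  field
    start     : Fin m
    δ         : Fin m → V → Fin m
    accepting : Fin m → Bool

Accepts : {V : Set} {m : ℕ} → DFA V m → List V → Set
Accepts A w = DFA.accepting A (foldl (DFA.δ A) (DFA.start A) w) ≡ true

-- REG^Z_n : accepted by some DFA (total transitions) with at most n states.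
REGZ : {V : Set} → ℕ → Language V → Set
REGZ {V} n L = Σ[ m ∈ ℕ ] (m ≤ n) × Σ[ A ∈ DFA V m ] (∀ w → L w ⇔ Accepts A w)

-- The "k-test" of the paper for words of length ≥ k (a₁…aₙ with n ≥ k):
-- prefix of length k in B, every inner factor a_{j+1}…a_{j+k} (1 ≤ j ≤ n-k-1) in I,
-- suffix of length k in E.  (Sets of words of length k are given as predicates
-- on words; only their values on words of length k matter.)
LongTest : {V : Set} (k : ℕ) (B I E : List V → Set) → List V → Set
LongTest k B I E w =
  (k ≤ length w) ×
  B (take k w) ×
  (∀ j → 1 ≤ j → j + k + 1 ≤ length w → I (take k (drop j w))) ×
  E (drop (length w Data.Nat.∸ k) w)

-- Strictly locally k-testable: L consists of the words of a finite set F of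
-- words of length at most k-1 (given as a predicate restricted to short words),
-- together with the long words passing the (B,I,E)-test.
SLTk : {V : Set} → ℕ → Language V → Set₁
SLTk {V} k L =
  Σ[ B ∈ (List V → Set) ] Σ[ I ∈ (List V → Set) ] Σ[ E ∈ (List V → Set) ]
  Σ[ F ∈ (List V → Set) ]
  (∀ w → L w ⇔ ((length w < k × F w) ⊎ LongTest k B I E w))

SLT : {V : Set} → Language V → Set₁
SLT L = Σ[ k ∈ ℕ ] (1 ≤ k) × SLTk k L

data AB : Set where
  a b : AB

L₁ : Language AB
L₁ w = Σ[ m ∈ ℕ ] Σ[ v ∈ List AB ] (w ≡ replicate m a ++ (b ∷ v))

{-# OPTIONS --safe #-}
-- The automaton stays in its start state while reading a's and moves, at the
-- first b, to an accepting sink.  For non-membership in SLT: given k, both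
-- aᵏb and baᵏ lie in L₁, so aᵏ passes the prefix test and the suffix test;
-- a word of length exactly k has no inner factor to test, so aᵏ would lie in
-- L₁ although it contains no b.
module Submission where

open import Defs
open import Data.Bool using (true; false)
open import Data.Empty using (⊥-elim)
open import Data.Fin using (Fin; zero; suc)
open import Data.List using (List; []; _∷_; _++_; replicate; foldl; length; take; drop)
open import Data.List.Properties using (∷-injectiveʳ; length-++; length-++-≤ˡ; length-++-≤ʳ; length-replicate; take-all)
open import Data.Nat using (ℕ; zero; suc; _+_; _∸_; _≤_; _<_)
open import Data.Nat.Properties using (≤-refl; ≤-trans; <⇒≱; m≤n+m; m+1+n≰m; m+n∸n≡m; n∸n≡0)
open import Data.Product using (_×_; _,_)
open import Data.Sum using (_⊎_; inj₁; inj₂)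
open import Function.Bundles using (_⇔_; mk⇔; Equivalence)
open import Relation.Binary.PropositionalEquality using (_≡_; refl; sym; cong; subst; module ≡-Reasoning)
open import Relation.Nullary using (¬_)

private
  variable
    V : Set

take-length-++ : (xs ys : List V) → take (length xs) (xs ++ ys) ≡ xs
take-length-++ []       ys = refl
take-length-++ (x ∷ xs) ys = cong (x ∷_) (take-length-++ xs ys)

drop-length-++ : (xs ys : List V) → drop (length xs) (xs ++ ys) ≡ ys
drop-length-++ []       ys = refl
drop-length-++ (x ∷ xs) ys = drop-length-++ xs ys

drop-length-∸-++ : (xs ys : List V) → drop (length (xs ++ ys) ∸ length ys) (xs ++ ys) ≡ ys
drop-length-∸-++ xs ys = begin
  drop (length (xs ++ ys) ∸ length ys) (xs ++ ys)      ≡⟨ cong (λ n → drop (n ∸ length ys) (xs ++ ys)) (length-++ xs) ⟩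
  drop (length xs + length ys ∸ length ys) (xs ++ ys)  ≡⟨ cong (λ n → drop n (xs ++ ys)) (m+n∸n≡m (length xs) (length ys)) ⟩
  drop (length xs) (xs ++ ys)                          ≡⟨ drop-length-++ xs ys ⟩
  ys                                                   ∎
  where open ≡-Reasoning

LongTest-length : (B I E : List V → Set) (x : List V) → B x → E x → LongTest (length x) B I E x
LongTest-length B I E x Bx Ex = ≤-refl , subst B (sym (take-all n x ≤-refl)) Bx , noInner , Ex′
  where
    n = length x
    noInner : ∀ j → 1 ≤ j → j + n + 1 ≤ n → I (take n (drop j x))
    noInner j _ bound = ⊥-elim (m+1+n≰m (j + n) (≤-trans bound (m≤n+m n j)))
    Ex′ : E (drop (n ∸ n) x)
    Ex′ = subst (λ i → E (drop i x)) (sym (n∸n≡0 n)) Ex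

module _ {k : ℕ} {L : Language V} {B I E F : List V → Set}
         (L⇔ : ∀ w → L w ⇔ ((length w < k × F w) ⊎ LongTest k B I E w)) where

  SLTk-long : ∀ {w} → k ≤ length w → L w → LongTest k B I E w
  SLTk-long {w} k≤∣w∣ Lw with Equivalence.to (L⇔ w) Lw
  ... | inj₁ (∣w∣<k , _) = ⊥-elim (<⇒≱ ∣w∣<k k≤∣w∣)
  ... | inj₂ test        = test

  SLTk-prefix-suffix-closed : ∀ {x u v : List V} → length x ≡ k → L (x ++ u) → L (v ++ x) → L x
  SLTk-prefix-suffix-closed {x} {u} {v} refl Lxu Lvx =
    Equivalence.from (L⇔ x) (inj₂ (LongTest-length B I E x Bx Ex))
    where
      Bx : B x
      Bx with SLTk-long (length-++-≤ˡ x) Lxu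
      ... | _ , B-prefix , _ = subst B (take-length-++ x u) B-prefix
      Ex : E x
      Ex with SLTk-long (length-++-≤ʳ x {v}) Lvx
      ... | _ , _ , _ , E-suffix = subst E (drop-length-∸-++ v x) E-suffix

L₁-tail : ∀ {w} → L₁ (a ∷ w) → L₁ w
L₁-tail (suc m , v , eq) = m , v , ∷-injectiveʳ eq

¬L₁-replicate-a : ∀ k → ¬ L₁ (replicate k a)
¬L₁-replicate-a zero    (zero  , _ , ())
¬L₁-replicate-a zero    (suc _ , _ , ())
¬L₁-replicate-a (suc k) w∈L₁ = ¬L₁-replicate-a k (L₁-tail w∈L₁)

¬SLT-L₁ : ¬ SLT L₁
¬SLT-L₁ (k , _ , B , I , E , _ , L₁⇔) =
  ¬L₁-replicate-a k
    (SLTk-prefix-suffix-closed {B = B} {I = I} {E = E} L₁⇔ (length-replicate k)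
      (k , [] , refl) (zero , replicate k a , refl))

δ₁ : Fin 2 → AB → Fin 2
δ₁ zero    a = zero
δ₁ zero    b = suc zero
δ₁ (suc _) _ = suc zero

M₁ : DFA AB 2
M₁ = record { start = zero ; δ = δ₁ ; accepting = λ { zero → false ; (suc _) → true } }

run-from-sink : ∀ w → foldl δ₁ (suc zero) w ≡ suc zero
run-from-sink []      = refl
run-from-sink (_ ∷ w) = run-from-sink w

M₁-accepts-L₁ : ∀ {w} → L₁ w → Accepts M₁ w
M₁-accepts-L₁ (zero  , v , refl) rewrite run-from-sink v = refl
M₁-accepts-L₁ (suc m , v , refl) = M₁-accepts-L₁ (m , v , refl)

M₁-accepts⇒L₁ : ∀ w → Accepts M₁ w → L₁ w
M₁-accepts⇒L₁ []      ()
M₁-accepts⇒L₁ (a ∷ w) acc with M₁-accepts⇒L₁ w acc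
... | m , v , eq = suc m , v , cong (a ∷_) eq
M₁-accepts⇒L₁ (b ∷ w) _ = zero , w , refl

L₁∈REGZ₂ : REGZ 2 L₁
L₁∈REGZ₂ = 2 , ≤-refl , M₁ , λ w → mk⇔ M₁-accepts-L₁ (M₁-accepts⇒L₁ w)

lemma1 : REGZ 2 L₁ × ¬ SLT L₁
lemma1 = L₁∈REGZ₂ , ¬SLT-L₁
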